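{- Let $G=(V,E)$ be a graph on $n$ vertices, $k\ge 0$ an integer, $c$ a $2$-valid edge coloring of $G$ using at least $n-k$ colors, and $H$ a character subgraph of $G$ with respect to $c$. Suppose the connected components of $H$ consist of $s$ paths (on $p_1,\dots,p_s$ vertices) and $r$ cycles (of lengths $c_1,\dots,c_r$). Then $s\le k$.
   Context: All graphs are finite, simple and undirected. An edge coloring of $G$ using $m$ colors is a surjective map $c:E\to[m]$; it is $2$-valid if for every vertex $v$ the edges incident to $v$ receive at most $2$ distinct colors. A character subgraph of $G$ with respect to $c$ is obtained by choosing, for each color $i\in[m]$, one edge $e_i$ with $c(e_i)=i$, and letting $H$ be the subgraph formed by the edges $e_1,\dots,e_m$ and their endpoints. Such $H$ has maximum degree at most $2$, so its components are paths and cycles. -}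

module Defs where

open import Data.Nat using (ℕ; zero; suc; _≤_; _<_; _∸_)
open import Data.Fin using (Fin; toℕ)
open import Data.Product using (Σ; ∃; ∃-syntax; _×_; _,_; proj₁; proj₂)
open import Data.Sum using (_⊎_; inj₁; inj₂)
open import Relation.Binary.PropositionalEquality using (_≡_)
open import Function.Bundles using (_⇔_)
open import Data.Empty using (⊥)

-- Its edges are indexed by
-- Fin M; edge e joins proj₁ (ends e) and proj₂ (ends e), stored with the
-- smaller endpoint first (so no loops), and distinct indices give distinct
-- edges (no multi-edges).
record Graph (n : ℕ) : Set where
  field
    M        : ℕ
    ends     : Fin M → Fin n × Fin n
    ordered  : ∀ e → toℕ (proj₁ (ends e)) < toℕ (proj₂ (ends e))
    distinct : ∀ e f → ends e ≡ ends f → e ≡ f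
open Graph public

IncidentTo : ∀ {n} (G : Graph n) → Fin (M G) → Fin n → Set
IncidentTo G e v = proj₁ (ends G e) ≡ v ⊎ proj₂ (ends G e) ≡ v

-- an edge coloring with m colors: a surjective map E → [m]
Surjective : ∀ {a b : ℕ} → (Fin a → Fin b) → Set
Surjective {a} {b} c = ∀ (i : Fin b) → ∃[ e ] c e ≡ i

-- 2-valid: at every vertex the incident edges receive at most 2 distinct colors
TwoValid : ∀ {n m} (G : Graph n) → (Fin (M G) → Fin m) → Set
TwoValid G c = ∀ v e₁ e₂ e₃ → IncidentTo G e₁ v → IncidentTo G e₂ v → IncidentTo G e₃ v →
  (c e₁ ≡ c e₂) ⊎ ((c e₁ ≡ c e₃) ⊎ (c e₂ ≡ c e₃))

-- a character subgraph is determined by a choice of one edge of each color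
IsCharacterChoice : ∀ {n m} (G : Graph n) → (Fin (M G) → Fin m) → (Fin m → Fin (M G)) → Set
IsCharacterChoice G c σ = ∀ i → c (σ i) ≡ i

InH : ∀ {n m} (G : Graph n) → (Fin m → Fin (M G)) → Fin n → Set
InH G σ v = ∃[ i ] IncidentTo G (σ i) v

AdjH : ∀ {n m} (G : Graph n) → (Fin m → Fin (M G)) → Fin n → Fin n → Set
AdjH G σ u v = ∃[ i ] (ends G (σ i) ≡ (u , v) ⊎ ends G (σ i) ≡ (v , u))

-- The model graph: disjoint union of s paths P_{p j} (p j vertices) and
-- r cycles C_{cl j} (cl j vertices / edges).
ModelV : (s : ℕ) (p : Fin s → ℕ) (r : ℕ) (cl : Fin r → ℕ) → Set
ModelV s p r cl = Σ (Fin s) (λ j → Fin (p j)) ⊎ Σ (Fin r) (λ j → Fin (cl j))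

PathSucc : ∀ {q} → Fin q → Fin q → Set
PathSucc a b = toℕ b ≡ suc (toℕ a)

CycSucc : ∀ {q} → Fin q → Fin q → Set
CycSucc {q} a b = toℕ b ≡ suc (toℕ a) ⊎ (suc (toℕ a) ≡ q × toℕ b ≡ 0)

ModelAdj : ∀ {s p r cl} → ModelV s p r cl → ModelV s p r cl → Set
ModelAdj (inj₁ (j , a)) (inj₁ (j' , b)) =
  Σ (j ≡ j') λ { _≡_.refl → PathSucc a b ⊎ PathSucc b a }
ModelAdj (inj₂ (j , a)) (inj₂ (j' , b)) =
  Σ (j ≡ j') λ { _≡_.refl → CycSucc a b ⊎ CycSucc b a }
ModelAdj _ _ = ⊥

-- H is isomorphic to the disjoint union of paths on p 1..p s vertices and
-- cycles of lengths cl 1..cl r (i.e. these are exactly its components).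
record PathCycleDecomp {n m} (G : Graph n) (σ : Fin m → Fin (M G))
         (s : ℕ) (p : Fin s → ℕ) (r : ℕ) (cl : Fin r → ℕ) : Set where
  field
    pathsNonempty : ∀ j → 1 ≤ p j
    cyclesLong    : ∀ j → 3 ≤ cl j
    φ             : ModelV s p r cl → Fin n
    φ-injective   : ∀ x y → φ x ≡ φ y → x ≡ y
    φ-intoH       : ∀ x → InH G σ (φ x)
    φ-ontoH       : ∀ v → InH G σ v → ∃[ x ] φ x ≡ v
    φ-adj         : ∀ x y → ModelAdj x y ⇔ AdjH G σ (φ x) (φ y)

module Submission where

-- Orient every edge of the model graph (the disjoint union of the
-- paths and cycles that H is isomorphic to) from a vertex to its successor:
-- along a path towards higher indices, around a cycle cyclically.  In this
-- orientation every vertex has at most one predecessor, and the first vertex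
-- of each path has none.  Each colour i has a chosen edge σ i of H,
-- and we send i to the head of that oriented edge.  Two colours with the same
-- head have the same tail, hence edges with the same endpoints, hence the same
-- chosen edge and (since σ picks an edge of colour i) the same colour.  So the
-- colours together with the first vertices of the s paths inject into the vertices of the model
-- graph, and through the isomorphism φ into the n vertices of G: m + s ≤ n.
-- Combined with n ∸ k ≤ m this gives s ≤ k.

open import Defs
open import Data.Nat using (ℕ; _≤_; _<_; _∸_; _+_; suc)
open import Data.Nat.Properties
  using (≤-trans; ≤-reflexive; suc-injective; <-asym; ∸-monoʳ-≤; m+n≤o⇒m≤o∸n; m≤n+o⇒m∸n≤o; m≤n+m∸n; +-comm)
open import Data.Fin using (Fin; toℕ; fromℕ<; join; splitAt)
open import Data.Fin.Properties using (toℕ-injective; toℕ-fromℕ<; injective⇒≤; join-splitAt)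
open import Data.Product using (_,_; proj₁; proj₂)
open import Data.Sum using (_⊎_; inj₁; inj₂)
open import Relation.Binary.PropositionalEquality
open import Relation.Nullary using (¬_)
open import Function.Bundles using (Equivalence)
open import Data.Empty using (⊥; ⊥-elim)

⊎-injection⇒+≤ : ∀ {m s n} (f : Fin m ⊎ Fin s → Fin n)
  → (∀ {x y} → f x ≡ f y → x ≡ y) → m + s ≤ n
⊎-injection⇒+≤ {m} {s} {n} f f-injective = injective⇒≤ {f = f∘split} split-injective
  where
  f∘split : Fin (m + s) → Fin n
  f∘split z = f (splitAt m z)

  split-injective : ∀ {x y} → f∘split x ≡ f∘split y → x ≡ y
  split-injective {x} {y} e = begin
    x                       ≡⟨ sym (join-splitAt m s x) ⟩
    join m s (splitAt m x)  ≡⟨ cong (join m s) (f-injective e) ⟩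
    join m s (splitAt m y)  ≡⟨ join-splitAt m s y ⟩
    y                       ∎
    where open ≡-Reasoning

-- The arithmetic conclusion: s ≤ n ∸ m ≤ n ∸ (n ∸ k) ≤ k.
paths-bounded : ∀ n k m s → n ∸ k ≤ m → m + s ≤ n → s ≤ k
paths-bounded n k m s enough-colours counted =
  ≤-trans (m+n≤o⇒m≤o∸n s (≤-trans (≤-reflexive (+-comm s m)) counted))
    (≤-trans (∸-monoʳ-≤ n enough-colours)
      (m≤n+o⇒m∸n≤o n (n ∸ k) (≤-trans (m≤n+m∸n n k) (≤-reflexive (+-comm k (n ∸ k))))))

module OrientedModel {s : ℕ} {p : Fin s → ℕ} {r : ℕ} {cl : Fin r → ℕ} where

  data Arrow : ModelV s p r cl → ModelV s p r cl → Set where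
    path-arrow  : ∀ j {a b : Fin (p j)}  → PathSucc a b → Arrow (inj₁ (j , a)) (inj₁ (j , b))
    cycle-arrow : ∀ j {a b : Fin (cl j)} → CycSucc a b  → Arrow (inj₂ (j , a)) (inj₂ (j , b))

  adjacent⇒arrow : ∀ x y → ModelAdj x y → Arrow x y ⊎ Arrow y x
  adjacent⇒arrow (inj₁ (j , a)) (inj₁ (.j , b)) (refl , inj₁ a→b) = inj₁ (path-arrow j a→b)
  adjacent⇒arrow (inj₁ (j , a)) (inj₁ (.j , b)) (refl , inj₂ b→a) = inj₂ (path-arrow j b→a)
  adjacent⇒arrow (inj₂ (j , a)) (inj₂ (.j , b)) (refl , inj₁ a→b) = inj₁ (cycle-arrow j a→b)
  adjacent⇒arrow (inj₂ (j , a)) (inj₂ (.j , b)) (refl , inj₂ b→a) = inj₂ (cycle-arrow j b→a)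

  path-predecessor-unique : ∀ {q} {a a′ b : Fin q} → PathSucc a b → PathSucc a′ b → a ≡ a′
  path-predecessor-unique b≡1+a b≡1+a′ = toℕ-injective (suc-injective (trans (sym b≡1+a) b≡1+a′))

  cycle-predecessor-unique : ∀ {q} {a a′ b : Fin q} → CycSucc a b → CycSucc a′ b → a ≡ a′
  cycle-predecessor-unique (inj₁ b≡1+a) (inj₁ b≡1+a′) = path-predecessor-unique b≡1+a b≡1+a′
  cycle-predecessor-unique (inj₁ b≡1+a) (inj₂ (_ , b≡0)) with trans (sym b≡1+a) b≡0
  ... | ()
  cycle-predecessor-unique (inj₂ (_ , b≡0)) (inj₁ b≡1+a′) with trans (sym b≡1+a′) b≡0
  ... | ()
  cycle-predecessor-unique (inj₂ (1+a≡q , _)) (inj₂ (1+a′≡q , _)) =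
    toℕ-injective (suc-injective (trans 1+a≡q (sym 1+a′≡q)))

  arrow-predecessor-unique : ∀ {x x′ y} → Arrow x y → Arrow x′ y → x ≡ x′
  arrow-predecessor-unique (path-arrow j a→b) (path-arrow .j a′→b) =
    cong (λ a → inj₁ (j , a)) (path-predecessor-unique a→b a′→b)
  arrow-predecessor-unique (cycle-arrow j a→b) (cycle-arrow .j a′→b) =
    cong (λ a → inj₂ (j , a)) (cycle-predecessor-unique a→b a′→b)

  path-start-has-no-predecessor : ∀ {x} j (a : Fin (p j)) → toℕ a ≡ 0 → ¬ Arrow x (inj₁ (j , a))
  path-start-has-no-predecessor j a a≡0 (path-arrow .j a≡1+b) with trans (sym a≡0) a≡1+b
  ... | ()

Joins : ∀ {n} (G : Graph n) → Fin (M G) → Fin n → Fin n → Set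
Joins G e a b = ends G e ≡ (a , b) ⊎ ends G e ≡ (b , a)

endpoints-increasing : ∀ {n} (G : Graph n) e {a b} → ends G e ≡ (a , b) → toℕ a < toℕ b
endpoints-increasing G e e=ab = subst (λ ab → toℕ (proj₁ ab) < toℕ (proj₂ ab)) e=ab (ordered G e)

no-reversed-edges : ∀ {n} (G : Graph n) e e′ {a b}
  → ends G e ≡ (a , b) → ends G e′ ≡ (b , a) → ⊥
no-reversed-edges G e e′ e=ab e′=ba =
  <-asym (endpoints-increasing G e e=ab) (endpoints-increasing G e′ e′=ba)

joins-determines-edge : ∀ {n} (G : Graph n) {e e′ a b}
  → Joins G e a b → Joins G e′ a b → e ≡ e′
joins-determines-edge G {e} {e′} (inj₁ e=ab) (inj₁ e′=ab) = distinct G e e′ (trans e=ab (sym e′=ab))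
joins-determines-edge G {e} {e′} (inj₂ e=ba) (inj₂ e′=ba) = distinct G e e′ (trans e=ba (sym e′=ba))
joins-determines-edge G {e} {e′} (inj₁ e=ab) (inj₂ e′=ba) = ⊥-elim (no-reversed-edges G e e′ e=ab e′=ba)
joins-determines-edge G {e} {e′} (inj₂ e=ba) (inj₁ e′=ab) = ⊥-elim (no-reversed-edges G e′ e e′=ab e=ba)

character-choice-injective : ∀ {n m} (G : Graph n) (c : Fin (M G) → Fin m) (σ : Fin m → Fin (M G))
  → IsCharacterChoice G c σ → ∀ {i i′} → σ i ≡ σ i′ → i ≡ i′
character-choice-injective G c σ χ {i} {i′} σi≡σi′ = begin
  i          ≡⟨ sym (χ i) ⟩
  c (σ i)    ≡⟨ cong c σi≡σi′ ⟩
  c (σ i′)   ≡⟨ χ i′ ⟩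
  i′         ∎
  where open ≡-Reasoning

module HeadMap {n m} (G : Graph n) (σ : Fin m → Fin (M G))
  (σ-injective : ∀ {i i′} → σ i ≡ σ i′ → i ≡ i′)
  {s p r cl} (D : PathCycleDecomp G σ s p r cl) where

  open PathCycleDecomp D
  open OrientedModel {s} {p} {r} {cl}

  record OrientedEdge (i : Fin m) : Set where
    field
      tail head : ModelV s p r cl
      arrow     : Arrow tail head
      joins     : Joins G (σ i) (φ tail) (φ head)

  orient-between : ∀ i x y → ends G (σ i) ≡ (φ x , φ y) → OrientedEdge i
  orient-between i x y σi=xy with adjacent⇒arrow x y (Equivalence.from (φ-adj x y) (i , inj₁ σi=xy))
  ... | inj₁ x→y = record { tail = x ; head = y ; arrow = x→y ; joins = inj₁ σi=xy }
  ... | inj₂ y→x = record { tail = y ; head = x ; arrow = y→x ; joins = inj₂ σi=xy }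

  -- Both endpoints of σ i lie in H, hence come from model vertices.
  orient : ∀ i → OrientedEdge i
  orient i with φ-ontoH (proj₁ (ends G (σ i))) (i , inj₁ refl)
              | φ-ontoH (proj₂ (ends G (σ i))) (i , inj₂ refl)
  ... | x , φx≡a | y , φy≡b = orient-between i x y (cong₂ _,_ (sym φx≡a) (sym φy≡b))

  head : Fin m → ModelV s p r cl
  head i = OrientedEdge.head (orient i)

  -- Equal heads force equal tails, hence equal chosen edges and colours.
  same-head⇒same-colour : ∀ i i′ (o : OrientedEdge i) (o′ : OrientedEdge i′)
    → OrientedEdge.head o ≡ OrientedEdge.head o′ → i ≡ i′
  same-head⇒same-colour i i′ o o′ refl
    with refl ← arrow-predecessor-unique (OrientedEdge.arrow o) (OrientedEdge.arrow o′) =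
    σ-injective (joins-determines-edge G (OrientedEdge.joins o) (OrientedEdge.joins o′))

  head-injective : ∀ {i i′} → head i ≡ head i′ → i ≡ i′
  head-injective {i} {i′} = same-head⇒same-colour i i′ (orient i) (orient i′)

  path-start : ∀ j → ModelV s p r cl
  path-start j = inj₁ (j , fromℕ< (pathsNonempty j))

  -- A head has a predecessor (its tail), so it is never the start of a path.
  head-not-path-start : ∀ i j → head i ≢ path-start j
  head-not-path-start i j head≡start =
    path-start-has-no-predecessor j _ (toℕ-fromℕ< (pathsNonempty j))
      (subst (Arrow (OrientedEdge.tail (orient i))) head≡start (OrientedEdge.arrow (orient i)))

  label : Fin m ⊎ Fin s → Fin n
  label (inj₁ i) = φ (head i)
  label (inj₂ j) = φ (path-start j)

  label-injective : ∀ {x y} → label x ≡ label y → x ≡ y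
  label-injective {inj₁ i} {inj₁ i′} e = cong inj₁ (head-injective (φ-injective _ _ e))
  label-injective {inj₁ i} {inj₂ j}  e = ⊥-elim (head-not-path-start i j (φ-injective _ _ e))
  label-injective {inj₂ j} {inj₁ i}  e = ⊥-elim (head-not-path-start i j (φ-injective _ _ (sym e)))
  label-injective {inj₂ j} {inj₂ j′} e with refl ← φ-injective _ _ e = refl

  colours+paths≤vertices : m + s ≤ n
  colours+paths≤vertices = ⊎-injection⇒+≤ label label-injective

mainTheorem7 : ∀ (n : ℕ) (G : Graph n) (k m : ℕ)
    (c : Fin (M G) → Fin m) → Surjective c → TwoValid G c → n ∸ k ≤ m
    → (σ : Fin m → Fin (M G)) → IsCharacterChoice G c σ
    → (s : ℕ) (p : Fin s → ℕ) (r : ℕ) (cl : Fin r → ℕ)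
    → PathCycleDecomp G σ s p r cl
    → s ≤ k
mainTheorem7 n G k m c _ _ enough-colours σ χ s p r cl D =
  paths-bounded n k m s enough-colours (HeadMap.colours+paths≤vertices G σ σ-injective D)
  where
  σ-injective : ∀ {i i′} → σ i ≡ σ i′ → i ≡ i′
  σ-injective = character-choice-injective G c σ χ
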